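{- Fix $n\ge1$ and distinct propositional variables $p_{i,j}$ ($1\le i\le n+1$, $1\le j\le n$). Let $\vec P$ be the list $p_{1,1},\dots,p_{1,n},p_{2,1},\dots,p_{2,n},\dots,p_{n+1,1},\dots,p_{n+1,n}$. Then there are $\mathsf{posELNDT}$ proofs over the extension axioms $\mathcal T$, of size polynomial in $n$, of the sequent $\bigvee_{j=1}^n p_{1,j},\ \dots,\ \bigvee_{j=1}^n p_{n+1,j}\ \to\ t^{\vec P}_{n+1}$.
   Context: eNDT formulas: built from propositional variables, constants $0,1$ and extension variables by $\vee$ and decisions $\mathrm{dec}(A,p,B)$ ("if $p$ then $B$ else $A$", $p$ a propositional variable). $\mathrm{pd}(A,p,C):=\mathrm{dec}(A,p,A\vee C)$; positive formulas have only decisions of this form. An extension axiom $e\leftrightarrow A$ stands for sequents $e\to A$ and $A\to e$. Threshold axioms $\mathcal T$: for every list $\vec p$ of propositional variables and integer $k$, an extension variable $t^{\vec p}_k$, with axioms $t^{\epsilon}_0\leftrightarrow1$, $t^{\epsilon}_k\leftrightarrow0$ ($k\ne0$), $t^{p\vec p}_k\leftrightarrow\mathrm{pd}(t^{\vec p}_k,p,t^{\vec p}_{k-1})$ ($\epsilon$ empty list; $p\vec p$ = $\vec p$ with $p$ prepended). $\mathsf{posELNDT}$: sequents on multisets; initial sequents $0\to$, $\to1$, $p\to p$; cut; left/right weakening and contraction; $\vee$-left (from $\Gamma,A\to\Delta$ and $\Gamma,B\to\Delta$ infer $\Gamma,A\vee B\to\Delta$); $\vee$-right (from $\Gamma\to\Delta,A,B$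 infer $\Gamma\to\Delta,A\vee B$); positive decision left (from $\Gamma,A\to\Delta$ and $\Gamma,p,B\to\Delta$ infer $\Gamma,\mathrm{pd}(A,p,B)\to\Delta$) and right (from $\Gamma\to\Delta,A,p$ and $\Gamma\to\Delta,A,B$ infer $\Gamma\to\Delta,\mathrm{pd}(A,p,B)$); all formulas positive. A proof over a set of extension axioms: finite list of sequents, each an axiom sequent or derived by a rule (conclusion may contain extension variables). Size = number of symbols. -}

module Defs where

open import Data.Nat using (ℕ; zero; suc; _+_; _*_)
open import Data.Integer using (ℤ; +_; _-_)
open import Data.List using (List; []; _∷_; map; concatMap; allFin)
open import Data.Nat.ListAction using (sum)
open import Data.List.Relation.Unary.All using (All)
open import Data.List.Relation.Unary.Any using (Any)
open import Data.List.Relation.Binary.Permutation.Propositional using (_↭_)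
open import Data.Fin using (Fin)
open import Data.Product using (Σ; _×_; _,_; Σ-syntax)
open import Relation.Binary.PropositionalEquality using (_≡_)
open import Relation.Nullary using (¬_)

Var : Set
Var = ℕ

-- The only extension variables are the
-- threshold variables t^{ps}_k of the axiom set T.
-- pd A p C abbreviates dec(A,p,A ∨ C) (the only decisions allowed in
-- positive formulas).
data Fml : Set where
  var : Var → Fml
  thr : List Var → ℤ → Fml
  𝟎 𝟏 : Fml
  _∨_ : Fml → Fml → Fml
  pd  : Fml → Var → Fml → Fml

-- number of symbols; pd A p C is counted as dec(A,p,A ∨ C):
-- symbols dec, p, ∨ plus A twice and C once.
fsize : Fml → ℕ
fsize (var _)    = 1
fsize (thr _ _)  = 1
fsize 𝟎          = 1
fsize 𝟏          = 1
fsize (A ∨ B)    = 1 + fsize A + fsize B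
fsize (pd A p C) = 3 + fsize A + fsize A + fsize C

-- Sequents Γ → Δ; lists are read as multisets (see _≈ˢ_).
record Seq : Set where
  constructor _⇒_
  field
    ant : List Fml
    suc' : List Fml

open Seq public

_≈ˢ_ : Seq → Seq → Set
(Γ ⇒ Δ) ≈ˢ (Γ' ⇒ Δ') = (Γ ↭ Γ') × (Δ ↭ Δ')

ssize : Seq → ℕ
ssize (Γ ⇒ Δ) = 1 + sum (map fsize Γ) + sum (map fsize Δ)

-- Extension axioms T (each e ↔ A gives e → A and A → e).
data ExtAx : Seq → Set where
  eps0₁ : ExtAx ((thr [] (+ 0) ∷ []) ⇒ (𝟏 ∷ []))
  eps0₂ : ExtAx ((𝟏 ∷ []) ⇒ (thr [] (+ 0) ∷ []))
  epsk₁ : ∀ k → ¬ k ≡ + 0 → ExtAx ((thr [] k ∷ []) ⇒ (𝟎 ∷ []))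
  epsk₂ : ∀ k → ¬ k ≡ + 0 → ExtAx ((𝟎 ∷ []) ⇒ (thr [] k ∷ []))
  cons₁ : ∀ p ps k →
    ExtAx ((thr (p ∷ ps) k ∷ []) ⇒ (pd (thr ps k) p (thr ps (k - + 1)) ∷ []))
  cons₂ : ∀ p ps k →
    ExtAx ((pd (thr ps k) p (thr ps (k - + 1)) ∷ []) ⇒ (thr (p ∷ ps) k ∷ []))

data Rule : List Seq → Seq → Set where
  ax0  : Rule [] ((𝟎 ∷ []) ⇒ [])
  ax1  : Rule [] ([] ⇒ (𝟏 ∷ []))
  axp  : ∀ p → Rule [] ((var p ∷ []) ⇒ (var p ∷ []))
  cut  : ∀ Γ Δ A → Rule ((Γ ⇒ (A ∷ Δ)) ∷ ((A ∷ Γ) ⇒ Δ) ∷ []) (Γ ⇒ Δ)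
  wkL  : ∀ Γ Δ A → Rule ((Γ ⇒ Δ) ∷ []) ((A ∷ Γ) ⇒ Δ)
  wkR  : ∀ Γ Δ A → Rule ((Γ ⇒ Δ) ∷ []) (Γ ⇒ (A ∷ Δ))
  ctrL : ∀ Γ Δ A → Rule (((A ∷ A ∷ Γ) ⇒ Δ) ∷ []) ((A ∷ Γ) ⇒ Δ)
  ctrR : ∀ Γ Δ A → Rule ((Γ ⇒ (A ∷ A ∷ Δ)) ∷ []) (Γ ⇒ (A ∷ Δ))
  orL  : ∀ Γ Δ A B →
    Rule (((A ∷ Γ) ⇒ Δ) ∷ ((B ∷ Γ) ⇒ Δ) ∷ []) (((A ∨ B) ∷ Γ) ⇒ Δ)
  orR  : ∀ Γ Δ A B →
    Rule ((Γ ⇒ (A ∷ B ∷ Δ)) ∷ []) (Γ ⇒ ((A ∨ B) ∷ Δ))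
  pdL  : ∀ Γ Δ A p B →
    Rule (((A ∷ Γ) ⇒ Δ) ∷ ((var p ∷ B ∷ Γ) ⇒ Δ) ∷ []) ((pd A p B ∷ Γ) ⇒ Δ)
  pdR  : ∀ Γ Δ A p B →
    Rule ((Γ ⇒ (A ∷ var p ∷ Δ)) ∷ (Γ ⇒ (A ∷ B ∷ Δ)) ∷ []) (Γ ⇒ (pd A p B ∷ Δ))

data Justified (L : List Seq) (s : Seq) : Set where
  byAx   : ExtAx s → Justified L s
  byRule : (prems : List Seq) (c : Seq) → Rule prems c → c ≈ˢ s →
           All (λ q → Any (λ r → r ≈ˢ q) L) prems → Justified L s

-- Proof L: the list L (in reverse order, last line first) is a
-- posELNDT proof over T.
data Proof : List Seq → Set where
  []  : Proof []
  _∷_ : ∀ {L s} → Justified L s → Proof L → Proof (s ∷ L)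

proofSize : List Seq → ℕ
proofSize L = sum (map ssize L)

ProofOf : Seq → List Seq → Set
ProofOf s π = Σ[ L ∈ List Seq ] (π ≡ s ∷ L) × Proof π

bigOr : List Fml → Fml
bigOr []           = 𝟎
bigOr (x ∷ [])     = x
bigOr (x ∷ y ∷ xs) = x ∨ bigOr (y ∷ xs)

Distinct : {n : ℕ} → (Fin (suc n) → Fin n → Var) → Set
Distinct {n} p = ∀ i j i' j' → p i j ≡ p i' j' → (i ≡ i') × (j ≡ j')

Pvec : (n : ℕ) → (Fin (suc n) → Fin n → Var) → List Var
Pvec n p = concatMap (λ i → map (p i) (allFin n)) (allFin (suc n))

target : (n : ℕ) → (Fin (suc n) → Fin n → Var) → Seq
target n p =
  map (λ i → bigOr (map (λ j → var (p i j)) (allFin n))) (allFin (suc n))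
  ⇒ (thr (Pvec n p) (+ suc n) ∷ [])

-- Let R₁,…,R_{n+1} be the rows of (p_{i,j}). Unfolding a threshold axiom once gives
-- t^S_k → t^{xS}_k and x, t^Q_k → t^{xQ}_{k+1}; chaining the former and splitting ⋁R by
-- ∨-left yields ⋁R, t^S_k → t^{RS}_{k+1} in O(|R|²) lines. Cutting these sequents row by
-- row, starting from → t^ε_0, derives ⋁R₁,…,⋁R_m → t^{R₁⋯R_m}_m in O(m·|R|²) lines.
-- Every line is a sub-multiset of the row disjunctions plus a bounded number of symbols,
-- so it has size O(n²), and the whole proof has size O(n⁵).

module Submission where

open import Defs
open import Data.Nat using (ℕ; zero; suc; _+_; _*_; _^_; _≤_; _<_; _≤ᵇ_; z≤n; s≤s)
open import Data.Nat.Properties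
open import Data.Nat.ListAction using (sum)
open import Data.Nat.ListAction.Properties using (sum-++; sum-↭)
open import Data.Nat.Tactic.RingSolver using (solve-∀)
open import Data.Integer using (+_; _-_)
open import Data.Bool using (T)
open import Data.Fin using (Fin)
open import Data.List using (List; []; _∷_; _++_; map; length; concat; allFin)
open import Data.List.Properties using (map-++; length-map; map-∘; map-cong; length-tabulate)
open import Data.List.Relation.Unary.All as All using (All; []; _∷_)
open import Data.List.Relation.Unary.All.Properties using (map⁺; tabulate⁺)
open import Data.List.Relation.Unary.Any using (here)
open import Data.List.Relation.Unary.Any.Properties using (++⁺ˡ; ++⁺ʳ)
open import Data.List.Relation.Binary.Permutation.Propositional
  using (_↭_; ↭-refl; ↭-sym; ↭-trans; swap)
open import Data.List.Relation.Binary.Permutation.Propositional.Properties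
  using (shift; ↭-reverse; ++-comm)
  renaming (map⁺ to ↭-map⁺)
open import Data.Product using (Σ-syntax; _×_; _,_)
open import Function using (id; _$_)
open import Relation.Binary.PropositionalEquality
  using (_≡_; refl; sym; trans; cong; cong₂; subst)

sumF : List Fml → ℕ
sumF Γ = sum (map fsize Γ)

ssize-↭ : ∀ {Γ Γ' Δ} → Γ ↭ Γ' → ssize (Γ ⇒ Δ) ≡ ssize (Γ' ⇒ Δ)
ssize-↭ {Δ = Δ} p = cong (λ m → suc (m + sumF Δ)) (sum-↭ (↭-map⁺ fsize p))

ssize-∷ : ∀ A Γ Δ → ssize ((A ∷ Γ) ⇒ Δ) ≡ fsize A + ssize (Γ ⇒ Δ)
ssize-∷ A Γ Δ = trans (cong suc (+-assoc (fsize A) (sumF Γ) (sumF Δ)))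
                      (sym (+-suc (fsize A) (sumF Γ + sumF Δ)))

ssize-[] : ∀ Γ Δ → ssize (Γ ⇒ Δ) ≡ sumF Γ + ssize ([] ⇒ Δ)
ssize-[] Γ Δ = sym (+-suc (sumF Γ) (sumF Δ))

≈ˢ-refl : ∀ {s} → s ≈ˢ s
≈ˢ-refl = ↭-refl , ↭-refl

justified-++ʳ : ∀ {L s} L' → Justified L s → Justified (L ++ L') s
justified-++ʳ L' (byAx ax)                  = byAx ax
justified-++ʳ L' (byRule ps c r c≈s found) = byRule ps c r c≈s (All.map ++⁺ˡ found)

proof-++ : ∀ {L L'} → Proof L → Proof L' → Proof (L ++ L')
proof-++ []      π' = π'
proof-++ (j ∷ π) π' = justified-++ʳ _ j ∷ proof-++ π π'

proofSize-++ : ∀ L L' → proofSize (L ++ L') ≡ proofSize L + proofSize L'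
proofSize-++ L L' = trans (cong sum (map-++ ssize L L')) (sum-++ (map ssize L) (map ssize L'))

module Derivations (W : ℕ) where

  record Fits (s : Seq) : Set where
    constructor fits-in
    field
      ssize≤ : ssize s ≤ W
  open Fits

  -- k counts lines: every combinator below charges one unit per line it emits, which Fits.
  record Derivation (s : Seq) (k : ℕ) : Set where
    constructor derivation
    field
      earlier : List Seq
      proof   : Proof (s ∷ earlier)
      size≤   : proofSize (s ∷ earlier) ≤ k * W

  proofOf : ∀ {s k B} → Derivation s k → k * W ≤ B →
            Σ[ π ∈ List Seq ] (ProofOf s π × proofSize π ≤ B)
  proofOf {s} (derivation L π size≤) kW≤B = s ∷ L , (L , refl , π) , ≤-trans size≤ kW≤B

  raise : ∀ {s a b} → a ≤ b → Derivation s a → Derivation s b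
  raise a≤b (derivation L π size≤) = derivation L π (≤-trans size≤ (*-monoˡ-≤ W a≤b))

  axiom : ∀ {s} → ExtAx s → Fits s → Derivation s 1
  axiom ax w = derivation [] (byAx ax ∷ []) (+-monoˡ-≤ 0 (ssize≤ w))

  infer₀ : ∀ {c s} → Rule [] c → c ≈ˢ s → Fits s → Derivation s 1
  infer₀ {c} r c≈s w = derivation [] (byRule [] c r c≈s [] ∷ []) (+-monoˡ-≤ 0 (ssize≤ w))

  infer₁ : ∀ {s₁ c s s₁' a} → Rule (s₁ ∷ []) c → c ≈ˢ s → Fits s →
           Derivation s₁' a → s₁' ≈ˢ s₁ → Derivation s (suc a)
  infer₁ {c = c} r c≈s w (derivation L π size≤) e₁ =
    derivation (_ ∷ L) (byRule _ c r c≈s (here e₁ ∷ []) ∷ π) (+-mono-≤ (ssize≤ w) size≤)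

  infer₂ : ∀ {s₁ s₂ c s s₁' s₂' a b} → Rule (s₁ ∷ s₂ ∷ []) c → c ≈ˢ s → Fits s →
           Derivation s₁' a → s₁' ≈ˢ s₁ → Derivation s₂' b → s₂' ≈ˢ s₂ →
           Derivation s (suc (a + b))
  infer₂ {c = c} {s₁' = s₁'} {s₂'} {a} {b} r c≈s w
         (derivation L₁ π₁ size≤₁) e₁ (derivation L₂ π₂ size≤₂) e₂ =
    derivation (L₂' ++ L₁')
      (byRule _ c r c≈s (++⁺ʳ L₂' (here e₁) ∷ here e₂ ∷ []) ∷ proof-++ π₂ π₁)
      (+-mono-≤ (ssize≤ w) size≤)
    where
    L₁' = s₁' ∷ L₁
    L₂' = s₂' ∷ L₂
    size≤ : proofSize (L₂' ++ L₁') ≤ (a + b) * W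
    size≤ = begin
      proofSize (L₂' ++ L₁')         ≡⟨ proofSize-++ L₂' L₁' ⟩
      proofSize L₂' + proofSize L₁'  ≤⟨ +-mono-≤ size≤₂ size≤₁ ⟩
      b * W + a * W                  ≡⟨ +-comm (b * W) (a * W) ⟩
      a * W + b * W                  ≡⟨ *-distribʳ-+ W a b ⟨
      (a + b) * W                    ∎
      where open ≤-Reasoning

  weakenL : ∀ {Γ Δ a} A → Fits ((A ∷ Γ) ⇒ Δ) → Derivation (Γ ⇒ Δ) a →
            Derivation ((A ∷ Γ) ⇒ Δ) (suc a)
  weakenL {Γ} {Δ} A w d = infer₁ (wkL Γ Δ A) ≈ˢ-refl w d ≈ˢ-refl

  weakenR : ∀ {Γ Δ a} A → Fits (Γ ⇒ (A ∷ Δ)) → Derivation (Γ ⇒ Δ) a →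
            Derivation (Γ ⇒ (A ∷ Δ)) (suc a)
  weakenR {Γ} {Δ} A w d = infer₁ (wkR Γ Δ A) ≈ˢ-refl w d ≈ˢ-refl

  weakenL* : ∀ Γ {Γ' Δ a} → Fits ((Γ ++ Γ') ⇒ Δ) → Derivation (Γ' ⇒ Δ) a →
             Derivation ((Γ ++ Γ') ⇒ Δ) (length Γ + a)
  weakenL* []      w d = d
  weakenL* (A ∷ Γ) {Γ'} {Δ} w d =
    weakenL A w (weakenL* Γ (fits-in (≤-trans smaller (ssize≤ w))) d)
    where
    smaller : ssize ((Γ ++ Γ') ⇒ Δ) ≤ ssize ((A ∷ Γ ++ Γ') ⇒ Δ)
    smaller = ≤-trans (m≤n+m _ (fsize A)) (≤-reflexive (sym (ssize-∷ A (Γ ++ Γ') Δ)))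

  cut₁ : ∀ {Γ Γ' A C a b} → Fits (Γ ⇒ (C ∷ A ∷ [])) →
         Derivation (Γ ⇒ (A ∷ [])) a → Γ' ↭ (A ∷ Γ) → Derivation (Γ' ⇒ (C ∷ [])) b →
         Derivation (Γ ⇒ (C ∷ [])) (2 + a + b)
  cut₁ {Γ} {A = A} {C} w d₁ p d₂ =
    infer₂ (cut Γ (C ∷ []) A) ≈ˢ-refl (fits-in (≤-trans shorter (ssize≤ w)))
      (weakenR C w d₁) (↭-refl , swap C A ↭-refl) d₂ (p , ↭-refl)
    where
    shorter : ssize (Γ ⇒ (C ∷ [])) ≤ ssize (Γ ⇒ (C ∷ A ∷ []))
    shorter = +-monoʳ-≤ (suc (sumF Γ)) (+-monoʳ-≤ (fsize C) z≤n)

  ⇒-trans : ∀ {X Y Z a b} → Fits ((X ∷ []) ⇒ (Z ∷ Y ∷ [])) →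
            Derivation ((X ∷ []) ⇒ (Y ∷ [])) a → Derivation ((Y ∷ []) ⇒ (Z ∷ [])) b →
            Derivation ((X ∷ []) ⇒ (Z ∷ [])) (3 + a + b)
  ⇒-trans {X} {Y} {Z} {a} {b} w d₁ d₂ =
    raise (≤-reflexive (cong (λ m → 2 + m) (+-suc a b)))
      (cut₁ w d₁ (swap X Y ↭-refl) (weakenL X w' d₂))
    where
    same-size : ∀ x y z → suc (x + 0 + (z + (y + 0))) ≡ suc (x + (y + 0) + (z + 0))
    same-size = solve-∀
    w' : Fits ((X ∷ Y ∷ []) ⇒ (Z ∷ []))
    w' = fits-in (subst (_≤ W) (same-size (fsize X) (fsize Y) (fsize Z)) (ssize≤ w))

th : List Var → ℕ → Fml
th S k = thr S (+ k)

⋁_ : List Var → Fml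
⋁ R = bigOr (map var R)

rowLines : ℕ → ℕ
rowLines m = 17 + 62 * m + 11 * m * m

rowsLines : ℕ → ℕ → ℕ
rowsLines r m = 4 + m * (3 + m + rowLines r)

-- Each line has at most 40 symbols besides a sub-multiset of the row disjunctions,
-- whose total size W₀ bounds.
module Threshold (W₀ : ℕ) where
  open Derivations (40 + W₀) public

  -- On sequents without row disjunctions ssize evaluates to a numeral, so the implicit
  -- witness is found by computation.
  fits : ∀ {s} {_ : T (ssize s ≤ᵇ 40)} → Fits s
  fits {s} {small} = fits-in (≤-trans (≤ᵇ⇒≤ (ssize s) 40 small) (m≤m+n 40 W₀))

  fits-with : ∀ {B Γ Δ} → fsize B ≤ W₀ → {_ : T (ssize (Γ ⇒ Δ) ≤ᵇ 40)} →
              Fits ((B ∷ Γ) ⇒ Δ)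
  fits-with {B} {Γ} {Δ} B-fits {small} = fits-in $ begin
    ssize ((B ∷ Γ) ⇒ Δ)      ≡⟨ ssize-∷ B Γ Δ ⟩
    fsize B + ssize (Γ ⇒ Δ)  ≤⟨ +-mono-≤ B-fits (≤ᵇ⇒≤ (ssize (Γ ⇒ Δ)) 40 small) ⟩
    W₀ + 40                  ≡⟨ +-comm W₀ 40 ⟩
    40 + W₀                  ∎
    where open ≤-Reasoning

  fits-rows : ∀ {Γ Δ} → sumF Γ ≤ W₀ → {_ : T (ssize ([] ⇒ Δ) ≤ᵇ 40)} →
              Fits (Γ ⇒ Δ)
  fits-rows {Γ} {Δ} Γ-fits {small} = fits-in $ begin
    ssize (Γ ⇒ Δ)               ≡⟨ ssize-[] Γ Δ ⟩
    sumF Γ + ssize ([] ⇒ Δ)     ≤⟨ +-mono-≤ Γ-fits (≤ᵇ⇒≤ (ssize ([] ⇒ Δ)) 40 small) ⟩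
    W₀ + 40                     ≡⟨ +-comm W₀ 40 ⟩
    40 + W₀                     ∎
    where open ≤-Reasoning

  th-refl : ∀ S k → Derivation ((th S k ∷ []) ⇒ (th S k ∷ [])) 6
  th-refl []      zero    =
    raise (n≤1+n 5) (⇒-trans fits (axiom eps0₁ fits) (axiom eps0₂ fits))
  th-refl []      (suc k) =
    ⇒-trans fits (axiom (epsk₁ (+ suc k) λ ()) fits)
                 (weakenR (th [] (suc k)) fits (infer₀ ax0 ≈ˢ-refl fits))
  th-refl (x ∷ S) k       =
    raise (n≤1+n 5) (⇒-trans fits (axiom (cons₁ x S (+ k)) fits) (axiom (cons₂ x S (+ k)) fits))

  th-extend : ∀ x S k → Derivation ((th S k ∷ []) ⇒ (th (x ∷ S) k ∷ [])) 19
  th-extend x S k = ⇒-trans fits expanded (axiom (cons₂ x S (+ k)) fits)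
    where
    t' = thr S (+ k - + 1)
    expanded : Derivation ((th S k ∷ []) ⇒ (pd (th S k) x t' ∷ [])) 15
    expanded = infer₂ (pdR (th S k ∷ []) [] (th S k) x t') ≈ˢ-refl fits
      (weakenR (var x) fits (th-refl S k)) (↭-refl , swap _ _ ↭-refl)
      (weakenR t' fits (th-refl S k)) (↭-refl , swap _ _ ↭-refl)

  th-extend* : ∀ U S k → Derivation ((th S k ∷ []) ⇒ (th (U ++ S) k ∷ [])) (6 + 22 * length U)
  th-extend* []      S k = th-refl S k
  th-extend* (x ∷ U) S k =
    raise (≤-reflexive (lines (length U)))
      (⇒-trans fits (th-extend* U S k) (th-extend x (U ++ S) k))
    where
    lines : ∀ m → 3 + (6 + 22 * m) + 19 ≡ 6 + 22 * suc m
    lines = solve-∀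

  th-step : ∀ x Q k → Derivation ((var x ∷ th Q k ∷ []) ⇒ (th (x ∷ Q) (suc k) ∷ [])) 17
  th-step x Q k =
    -- cons₂ at index k+1 mentions t^Q_{(k+1)-1}, which reduces to t^Q_k
    cut₁ fits expanded (shift _ (var x ∷ th Q k ∷ []) [])
      (weakenL* (var x ∷ th Q k ∷ []) fits (axiom (cons₂ x Q (+ suc k)) fits))
    where
    expanded : Derivation ((var x ∷ th Q k ∷ []) ⇒ (pd (th Q (suc k)) x (th Q k) ∷ [])) 12
    expanded = infer₂ (pdR (var x ∷ th Q k ∷ []) [] (th Q (suc k)) x (th Q k)) ≈ˢ-refl fits
      (weakenR (th Q (suc k)) fits (weakenL (th Q k) fits (infer₀ (axp x) ≈ˢ-refl fits)))
      (swap _ _ ↭-refl , ↭-refl)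
      (weakenR (th Q (suc k)) fits (weakenL (var x) fits (th-refl Q k))) ≈ˢ-refl

  th-row : ∀ x R S k → fsize (⋁ (x ∷ R)) ≤ W₀ →
           Derivation ((⋁ (x ∷ R) ∷ th S k ∷ []) ⇒ (th ((x ∷ R) ++ S) (suc k) ∷ []))
                      (rowLines (length R))
  th-row x []      S k _   = th-step x S k
  th-row x (y ∷ R) S k fit =
    raise (≤-reflexive (lines (length R)))
      (infer₂ (orL (th S k ∷ []) (Tf ∷ []) (var x) b') ≈ˢ-refl (fits-with fit)
         via-x ≈ˢ-refl via-b' ≈ˢ-refl)
    where
    b' = ⋁ (y ∷ R)
    Q  = (y ∷ R) ++ S
    Tf = th (x ∷ Q) (suc k)
    fit' : fsize b' ≤ W₀
    fit' = ≤-trans (m≤n+m (fsize b') 2) fit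
    via-x : Derivation ((var x ∷ th S k ∷ []) ⇒ (Tf ∷ []))
                       (2 + (1 + (6 + 22 * suc (length R))) + (1 + 17))
    via-x = cut₁ fits (weakenL (var x) fits (th-extend* (y ∷ R) S k)) (↭-sym (↭-reverse _))
                 (weakenL (th S k) fits (th-step x Q k))
    via-b' : Derivation ((b' ∷ th S k ∷ []) ⇒ (Tf ∷ [])) (2 + rowLines (length R) + (2 + 19))
    via-b' = cut₁ (fits-with fit') (th-row y R S k fit') (shift _ (b' ∷ th S k ∷ []) [])
                  (weakenL* (b' ∷ th S k ∷ []) (fits-with fit') (th-extend x Q (suc k)))
    lines : ∀ m → suc ((2 + (1 + (6 + 22 * suc m)) + (1 + 17)) + (2 + rowLines m + (2 + 19)))
                  ≡ rowLines (suc m)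
    lines = poly
      where
      -- restated with rowLines unfolded, which the ring solver does not do
      poly : ∀ m → suc ((2 + (1 + (6 + 22 * suc m)) + (1 + 17))
                        + (2 + (17 + 62 * m + 11 * m * m) + (2 + 19)))
                   ≡ 17 + 62 * suc m + 11 * suc m * suc m
      poly = solve-∀

  th-rows : ∀ r Rs → All (λ R → length R ≡ suc r) Rs → sumF (map ⋁_ Rs) < W₀ →
            Derivation (map ⋁_ Rs ⇒ (th (concat Rs) (length Rs) ∷ [])) (rowsLines r (length Rs))
  th-rows r []             []           _   =
    cut₁ fits (infer₀ ax1 ≈ˢ-refl fits) ↭-refl (axiom eps0₂ fits)
  th-rows r ((x ∷ R) ∷ Rs) (len ∷ lens) fit =
    raise lines≤
      (cut₁ (fits-rows (<⇒≤ fit)) (weakenL b (fits-rows (<⇒≤ fit)) (th-rows r Rs lens fit-Γ))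
            perm (weakenL* Γ fit-last (th-row x R (concat Rs) m fit-b)))
    where
    b  = ⋁ (x ∷ R)
    Γ  = map ⋁_ Rs
    m  = length Rs
    Tc = th (concat Rs) m
    Tf = th ((x ∷ R) ++ concat Rs) (suc m)
    fit-Γ : sumF Γ < W₀
    fit-Γ = ≤-trans (s≤s (m≤n+m (sumF Γ) (fsize b))) fit
    fit-b : fsize b ≤ W₀
    fit-b = ≤-trans (m≤m+n (fsize b) (sumF Γ)) (<⇒≤ fit)
    perm : (Γ ++ b ∷ Tc ∷ []) ↭ (Tc ∷ b ∷ Γ)
    perm = ↭-trans (++-comm Γ (b ∷ Tc ∷ [])) (swap b Tc ↭-refl)
    fit-reordered : Fits ((Tc ∷ b ∷ Γ) ⇒ (Tf ∷ []))
    fit-reordered = fits-rows fit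
    fit-last : Fits ((Γ ++ b ∷ Tc ∷ []) ⇒ (Tf ∷ []))
    fit-last = fits-in (subst (_≤ 40 + W₀) (sym (ssize-↭ {Δ = Tf ∷ []} perm)) (Fits.ssize≤ fit-reordered))
    lines≤ : 2 + suc (rowsLines r m) + (length Γ + rowLines (length R)) ≤ rowsLines r (suc m)
    lines≤ = begin
      2 + suc (rowsLines r m) + (length Γ + rowLines (length R))
        ≡⟨ cong₂ (λ l l' → 2 + suc (rowsLines r m) + (l + rowLines l'))
                 (length-map ⋁_ Rs) (suc-injective len) ⟩
      3 + rowsLines r m + (m + rowLines r)
        ≤⟨ m≤m+n _ (suc m) ⟩
      3 + rowsLines r m + (m + rowLines r) + suc m
        ≡⟨ poly r m ⟩
      rowsLines r (suc m) ∎
      where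
      open ≤-Reasoning
      poly : ∀ r m → 3 + (4 + m * (3 + m + (17 + 62 * r + 11 * r * r)))
                       + (m + (17 + 62 * r + 11 * r * r)) + suc m
                     ≡ 4 + suc m * (3 + suc m + (17 + 62 * r + 11 * r * r))
      poly = solve-∀

fsize-⋁ : ∀ x R → fsize (⋁ (x ∷ R)) ≡ suc (length R + length R)
fsize-⋁ x []      = refl
fsize-⋁ x (y ∷ R) =
  cong (λ m → suc (suc m)) (trans (fsize-⋁ y R) (sym (+-suc (length R) (length R))))

sumF-⋁ : ∀ {r} Rs → All (λ R → length R ≡ suc r) Rs →
         sumF (map ⋁_ Rs) ≡ length Rs * suc (r + r)
sumF-⋁ []             []           = refl
sumF-⋁ ((x ∷ R) ∷ Rs) (len ∷ lens) =
  cong₂ _+_ (trans (fsize-⋁ x R) (cong (λ l → suc (l + l)) (suc-injective len))) (sumF-⋁ Rs lens)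

rows : ∀ n → (Fin (suc n) → Fin n → Var) → List (List Var)
rows n p = map (λ i → map (p i) (allFin n)) (allFin (suc n))

length-rows : ∀ n p → length (rows n p) ≡ suc n
length-rows n p = trans (length-map _ (allFin (suc n))) (length-tabulate id)

rows-length : ∀ n p → All (λ R → length R ≡ n) (rows n p)
rows-length n p = map⁺ (tabulate⁺ λ i → trans (length-map (p i) (allFin n)) (length-tabulate id))

target-rows : ∀ n p →
  (map ⋁_ (rows n p) ⇒ (th (concat (rows n p)) (suc n) ∷ [])) ≡ target n p
target-rows n p = cong (_⇒ (th (Pvec n p) (suc n) ∷ []))
  (trans (sym (map-∘ (allFin (suc n))))
         (map-cong (λ i → cong bigOr (sym (map-∘ (allFin n)))) (allFin (suc n))))

lines-bound : ∀ r → rowsLines r (2 + r) ≤ 50 * suc r ^ 3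
lines-bound r = ≤-trans (m≤m+n _ _) (≤-reflexive (poly r))
  where
  poly : ∀ r → 4 + (2 + r) * (3 + (2 + r) + (17 + 62 * r + 11 * r * r))
               + (2 + 2 * r + 65 * (r * r) + 39 * (r * r * r))
               ≡ 50 * (suc r * (suc r * (suc r * 1)))
  poly = solve-∀

width-bound : ∀ r → 40 + suc ((2 + r) * suc (r + r)) ≤ 43 * suc r ^ 2
width-bound r = ≤-trans (m≤m+n _ _) (≤-reflexive (poly r))
  where
  poly : ∀ r → 40 + suc ((2 + r) * suc (r + r)) + (81 * r + 41 * (r * r))
               ≡ 43 * (suc r * (suc r * 1))
  poly = solve-∀

target-proof : ∀ r (p : Fin (2 + r) → Fin (suc r) → Var) →
               Σ[ π ∈ List Seq ] (ProofOf (target (suc r) p) π × proofSize π ≤ 2150 * suc r ^ 5)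
target-proof r p = proofOf derivation-target size-bound
  where
  Rs = rows (suc r) p
  W₀ = suc (sumF (map ⋁_ Rs))
  open Threshold W₀
  derivation-Rs : Derivation (map ⋁_ Rs ⇒ (th (concat Rs) (length Rs) ∷ []))
                             (rowsLines r (length Rs))
  derivation-Rs = th-rows r Rs (rows-length (suc r) p) ≤-refl
  derivation-target : Derivation (target (suc r) p) (rowsLines r (2 + r))
  derivation-target = subst (λ s → Derivation s (rowsLines r (2 + r))) (target-rows (suc r) p)
    (subst (λ m → Derivation (map ⋁_ Rs ⇒ (th (concat Rs) m ∷ [])) (rowsLines r m))
           (length-rows (suc r) p) derivation-Rs)
  size-bound : rowsLines r (2 + r) * (40 + W₀) ≤ 2150 * suc r ^ 5
  size-bound = begin
    rowsLines r (2 + r) * (40 + W₀)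
      ≡⟨ cong (λ w → rowsLines r (2 + r) * (40 + suc w))
              (trans (sumF-⋁ Rs (rows-length (suc r) p))
                     (cong (_* suc (r + r)) (length-rows (suc r) p))) ⟩
    rowsLines r (2 + r) * (40 + suc ((2 + r) * suc (r + r)))
      ≤⟨ *-mono-≤ (lines-bound r) (width-bound r) ⟩
    50 * suc r ^ 3 * (43 * suc r ^ 2)
      ≡⟨ poly (suc r) ⟩
    2150 * suc r ^ 5 ∎
    where
    open ≤-Reasoning
    poly : ∀ n → 50 * (n * (n * (n * 1))) * (43 * (n * (n * 1)))
                 ≡ 2150 * (n * (n * (n * (n * (n * 1)))))
    poly = solve-∀

mainTheorem12 : Σ[ c ∈ ℕ ] Σ[ d ∈ ℕ ] ((n : ℕ) → 1 ≤ n →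
                  (p : Fin (suc n) → Fin n → Var) → Distinct p →
                  Σ[ π ∈ List Seq ] (ProofOf (target n p) π × proofSize π ≤ c * n ^ d))
mainTheorem12 = 2150 , 5 , λ where
  -- the argument does not need the variables p_{i,j} to be distinct
  (suc r) _ p _ → target-proof r p
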